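{- Let $G\le\mathrm{Aut}(T)$ be a fractal group such that for every $n\ge1$, every vertex $u$ at level $n$ and every $k\ge1$, $\mathrm{St}_G(n)$ acts transitively on $\{uw:|w|=k\}$. Let $s\in G$ and suppose there exist a natural number $N\ge1$ and an element $g\in G$ such that (i) there are vertices $u,w\in T$ with $|u|\le|w|\le N$ both fixed by $g$, and (ii) $g|_u=1$ and $g|_w=s$. Then for every $n\ge1$ and every $v\in T$ with $|v|\ge n+N$ we have $s\in\mathrm{St}_G(n)_v$. In particular, if this holds for every element $s$ of a generating set of $G$ (with the same $N$), then $G$ is mixing with delay constant $N$.
   Context: $T$ is the $d$-regular rooted tree of words over $X=\{1,\dots,d\}$ ($d\ge2$), root $\emptyset$, $v$ adjacent to $vx$; $|v|$ is word length. For $g\in\mathrm{Aut}(T)$, the section $g|_v$ is the unique automorphism with $(vw)^g=v^gw^{g|_v}$ for all $w$; $\pi_m$ is restriction to the first $m$ levels and $g|_v^m=\pi_m(g|_v)$. For $H\le\mathrm{Aut}(T)$: $\mathrm{st}_H(v)$ is the vertex stabilizer, $\mathrm{St}_H(n)$ the pointwise stabilizer of level $n$, $H_v:=\{h|_v:h\in\mathrm{st}_H(v)\}$ and $H_v^m:=\{h|_v^m:h\in\mathrm{st}_H(v)\}$ (so $\mathrm{St}_G(n)_v=\{h|_v: h\in\mathrm{St}_G(n)\cap\mathrm{st}_G(v)\}$). $G$ is fractal if $g|_v\in G$ for all $g\in G,v\in T$, $G$ acts transitively on each level, and $G_v=G$ for every $v$. A fractal $G$ is mixing with delay constant $N$ if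 the level-stabilizer transitivity condition above holds and for all $n,m\ge1$ and all $v$ with $|v|\ge n+N$, $\mathrm{St}_G(n)_v^m=\pi_m(G)$. -}

module Defs where

open import Data.Nat using (ℕ; _≤_; _<_; _+_)
open import Data.Bool using (Bool; true; false)
open import Data.Fin using (Fin)
open import Data.Fin.Permutation as P using (Permutation′; _⟨$⟩ʳ_; _⟨$⟩ˡ_; _∘ₚ_)
open import Data.List using (List; []; _∷_; _++_; length)
open import Data.List.Relation.Unary.All using (All)
open import Data.Product using (Σ; ∃; ∃-syntax; _×_; _,_; proj₂)
open import Relation.Binary.PropositionalEquality using (_≡_)

-- The d-regular rooted tree: vertices are words over X = Fin d.

Word : ℕ → Set
Word d = List (Fin d)

-- An automorphism of T is represented by its portrait: the permutation
-- of X it induces below each vertex (its label g(v)).  Every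
-- automorphism corresponds to exactly one portrait.
Aut : ℕ → Set
Aut d = Word d → Permutation′ d

_≈ₚ_ : {d : ℕ} → Permutation′ d → Permutation′ d → Set
π ≈ₚ ρ = ∀ x → π ⟨$⟩ʳ x ≡ ρ ⟨$⟩ʳ x

_≈_ : {d : ℕ} → Aut d → Aut d → Set
g ≈ h = ∀ v → g v ≈ₚ h v

section : {d : ℕ} → Aut d → Word d → Aut d
section g v = λ w → g (v ++ w)

act : {d : ℕ} → Aut d → Word d → Word d
act g [] = []
act g (x ∷ w) = (g [] ⟨$⟩ʳ x) ∷ act (section g (x ∷ [])) w

actInv : {d : ℕ} → Aut d → Word d → Word d
actInv g [] = []
actInv g (x ∷ w) = (g [] ⟨$⟩ˡ x) ∷ actInv (section g ((g [] ⟨$⟩ˡ x) ∷ [])) w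

-- group structure of Aut(T) (right actions: v^(g·h) = (v^g)^h)
one : {d : ℕ} → Aut d
one = λ _ → P.id

_·_ : {d : ℕ} → Aut d → Aut d → Aut d
(g · h) v = g v ∘ₚ h (act g v)

inv : {d : ℕ} → Aut d → Aut d
inv g v = P.flip (g (actInv g v))

record IsSubgroup {d : ℕ} (G : Aut d → Set) : Set where
  field
    resp  : ∀ g h → g ≈ h → G g → G h
    one∈  : G one
    ·∈    : ∀ g h → G g → G h → G (g · h)
    inv∈  : ∀ g → G g → G (inv g)

Fixes : {d : ℕ} → Aut d → Word d → Set
Fixes g v = act g v ≡ v

InLevelStab : {d : ℕ} → ℕ → Aut d → Set
InLevelStab n g = ∀ v → length v ≡ n → Fixes g v

InStSection : {d : ℕ} → (Aut d → Set) → ℕ → Word d → Aut d → Set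
InStSection G n v k = ∃[ h ] (G h × InLevelStab n h × Fixes h v × section h v ≈ k)

InVertexSection : {d : ℕ} → (Aut d → Set) → Word d → Aut d → Set
InVertexSection G v k = ∃[ h ] (G h × Fixes h v × section h v ≈ k)

IsFractal : {d : ℕ} → (Aut d → Set) → Set
IsFractal {d} G =
  (∀ g v → G g → G (section g v))
  × (∀ (v v' : Word d) → length v ≡ length v' → ∃[ g ] (G g × act g v ≡ v'))
  × (∀ (v : Word d) (k : Aut d) → (InVertexSection G v k → G k) × (G k → InVertexSection G v k))

LevelStabTransitive : {d : ℕ} → (Aut d → Set) → Set
LevelStabTransitive {d} G =
  ∀ (n : ℕ) → 1 ≤ n → ∀ (u : Word d) → length u ≡ n →
  ∀ (k : ℕ) → 1 ≤ k → ∀ (w w' : Word d) → length w ≡ k → length w' ≡ k →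
  ∃[ h ] (G h × InLevelStab n h × act h (u ++ w) ≡ u ++ w')

AgreeUpTo : {d : ℕ} → ℕ → Aut d → Aut d → Set
AgreeUpTo {d} m g h = ∀ (v : Word d) → length v ≤ m → act g v ≡ act h v

IsMixing : {d : ℕ} → (Aut d → Set) → ℕ → Set
IsMixing {d} G N =
  IsFractal G × LevelStabTransitive G ×
  (∀ (n m : ℕ) → 1 ≤ n → 1 ≤ m → ∀ (v : Word d) → n + N ≤ length v →
     -- St_G(n)_v^m ⊆ π_m(G)
     (∀ h → G h → InLevelStab n h → Fixes h v → ∃[ g ] (G g × AgreeUpTo m (section h v) g))
     -- π_m(G) ⊆ St_G(n)_v^m
     × (∀ g → G g → ∃[ h ] (G h × InLevelStab n h × Fixes h v × AgreeUpTo m (section h v) g)))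

Condition : {d : ℕ} → (Aut d → Set) → ℕ → Aut d → Set
Condition {d} G N s =
  ∃[ g ] (G g × Σ (Word d) λ u → Σ (Word d) λ w →
    length u ≤ length w × length w ≤ N × Fixes g u × Fixes g w
    × section g u ≈ one × section g w ≈ s)

evalWord : {d : ℕ} → List (Bool × Aut d) → Aut d
evalWord [] = one
evalWord ((true , s) ∷ ws) = s · evalWord ws
evalWord ((false , s) ∷ ws) = inv s · evalWord ws

Generates : {d : ℕ} → (Aut d → Set) → (Aut d → Set) → Set
Generates {d} G S =
  (∀ s → S s → G s)
  × (∀ g → G g → ∃[ ws ] (All (λ p → S (proj₂ p)) ws × g ≈ evalWord ws))

-- Conjugating g by an element of G that carries w to the last |w| letters b of v,
-- and lifting the result to the prefix x of v (fractality), gives K ∈ G fixing x b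
-- with section s and fixing some x y, |y| = |b|, with trivial section.  Some
-- L ∈ St_G(|x|) carries x y to x b, so K^L fixes x b with trivial section and
-- agrees with K on level |x|; hence (K^L)⁻¹ K lies in St_G(n), fixes v and has
-- section s there.  Since St_G(n)_v is a subgroup, it then contains the subgroup
-- generated by the elements satisfying the condition.
module Submission where

open import Defs
open import Data.Bool using (true; false)
open import Data.Fin using (Fin; zero)
open import Data.Fin.Permutation as P using (Permutation′; _⟨$⟩ʳ_; _⟨$⟩ˡ_)
open import Data.List using ([]; _∷_; _++_; length; replicate; take; drop)
open import Data.List.Properties
  using (length-++; ++-assoc; length-replicate; ∷-injective; take++drop≡id; length-drop)
open import Data.List.Relation.Unary.All using (All; []; _∷_)
open import Data.Nat using (ℕ; suc; _≤_; _+_; _∸_; s≤s; z≤n)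
open import Data.Nat.Properties
  using (suc-injective; ≤-trans; m≤n+m; +-monoʳ-≤; +-cancelʳ-≤; m∸[m∸n]≡n; m+[n∸m]≡n; module ≤-Reasoning)
open import Data.Product using (∃-syntax; _×_; _,_; proj₁; proj₂)
open import Relation.Binary.PropositionalEquality
  using (_≡_; refl; sym; trans; cong; cong₂; subst; module ≡-Reasoning)

private variable
  d m n : ℕ
  g h k a b α β : Aut d
  u v w y z : Word d

-- _≈_ wrapped in a record so that Agda can infer its two sides.
record _≋_ {d : ℕ} (g h : Aut d) : Set where
  constructor ⟦_⟧
  field ≋⇒≈ : g ≈ h
open _≋_

infix 4 _≋_

≋-refl : g ≋ g
≋-refl = ⟦ (λ _ _ → refl) ⟧

≋-sym : g ≋ h → h ≋ g
≋-sym ⟦ e ⟧ = ⟦ (λ v x → sym (e v x)) ⟧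

≋-trans : g ≋ h → h ≋ k → g ≋ k
≋-trans ⟦ e ⟧ ⟦ f ⟧ = ⟦ (λ v x → trans (e v x) (f v x)) ⟧

⟨$⟩ˡ-cong : (π ρ : Permutation′ d) → π ≈ₚ ρ → ∀ x → π ⟨$⟩ˡ x ≡ ρ ⟨$⟩ˡ x
⟨$⟩ˡ-cong π ρ π≈ρ x = begin
  π ⟨$⟩ˡ x                   ≡⟨ cong (π ⟨$⟩ˡ_) (sym (P.inverseʳ ρ)) ⟩
  π ⟨$⟩ˡ (ρ ⟨$⟩ʳ (ρ ⟨$⟩ˡ x))  ≡⟨ cong (π ⟨$⟩ˡ_) (sym (π≈ρ (ρ ⟨$⟩ˡ x))) ⟩
  π ⟨$⟩ˡ (π ⟨$⟩ʳ (ρ ⟨$⟩ˡ x))  ≡⟨ P.inverseˡ π ⟩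
  ρ ⟨$⟩ˡ x                   ∎
  where open ≡-Reasoning

section-≡ : (g : Aut d) → v ≡ w → section g v ≋ section g w
section-≡ g refl = ≋-refl

section-cong : g ≋ h → ∀ v → section g v ≋ section h v
section-cong ⟦ e ⟧ v = ⟦ (λ w → e (v ++ w)) ⟧

act-cong : g ≋ h → ∀ w → act g w ≡ act h w
act-cong e []      = refl
act-cong e (x ∷ w) = cong₂ _∷_ (≋⇒≈ e [] x) (act-cong (section-cong e (x ∷ [])) w)

actInv-cong : g ≋ h → ∀ w → actInv g w ≡ actInv h w
actInv-cong {g = g} {h} e [] = refl
actInv-cong {g = g} {h} e (x ∷ w) =
  cong₂ _∷_ x⁻ (trans (cong (λ y → actInv (section g (y ∷ [])) w) x⁻)
                      (actInv-cong (section-cong e ((h [] ⟨$⟩ˡ x) ∷ [])) w))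
  where x⁻ = ⟨$⟩ˡ-cong (g []) (h []) (≋⇒≈ e []) x

act-length : (g : Aut d) (w : Word d) → length (act g w) ≡ length w
act-length g []      = refl
act-length g (x ∷ w) = cong suc (act-length (section g (x ∷ [])) w)

act-++ : (g : Aut d) (v w : Word d) → act g (v ++ w) ≡ act g v ++ act (section g v) w
act-++ g []      w = refl
act-++ g (x ∷ v) w = cong (_ ∷_) (act-++ (section g (x ∷ [])) v w)

actInv-++ : (g : Aut d) (v w : Word d) →
            actInv g (v ++ w) ≡ actInv g v ++ actInv (section g (actInv g v)) w
actInv-++ g []      w = refl
actInv-++ g (x ∷ v) w = cong (_ ∷_) (actInv-++ (section g ((g [] ⟨$⟩ˡ x) ∷ [])) v w)

act-one : (w : Word d) → act one w ≡ w
act-one []      = refl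
act-one (x ∷ w) = cong (x ∷_) (act-one w)

act-· : (g h : Aut d) (w : Word d) → act (g · h) w ≡ act h (act g w)
act-· g h []      = refl
act-· g h (x ∷ w) = cong (_ ∷_) (act-· (section g (x ∷ [])) (section h ((g [] ⟨$⟩ʳ x) ∷ [])) w)

act-inv : (g : Aut d) (w : Word d) → act (inv g) w ≡ actInv g w
act-inv g []      = refl
act-inv g (x ∷ w) = cong (_ ∷_) (act-inv (section g ((g [] ⟨$⟩ˡ x) ∷ [])) w)

actInv-act : (g : Aut d) (w : Word d) → actInv g (act g w) ≡ w
actInv-act g []      = refl
actInv-act g (x ∷ w) rewrite P.inverseˡ (g []) {x} = cong (x ∷_) (actInv-act (section g (x ∷ [])) w)

act-actInv : (g : Aut d) (w : Word d) → act g (actInv g w) ≡ w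
act-actInv g []      = refl
act-actInv g (x ∷ w) rewrite P.inverseʳ (g []) {x} =
  cong (x ∷_) (act-actInv (section g ((g [] ⟨$⟩ˡ x) ∷ [])) w)

section-· : (g h : Aut d) (v : Word d) → section (g · h) v ≋ section g v · section h (act g v)
section-· g h v = ⟦ (λ w x → cong (λ z → h z ⟨$⟩ʳ (g (v ++ w) ⟨$⟩ʳ x)) (act-++ g v w)) ⟧

section-inv : (g : Aut d) (v : Word d) → section (inv g) v ≋ inv (section g (actInv g v))
section-inv g v = ⟦ (λ w x → cong (λ z → g z ⟨$⟩ˡ x) (actInv-++ g v w)) ⟧

section-++ : (g : Aut d) (v w : Word d) → section g (v ++ w) ≋ section (section g v) w
section-++ g v w = ⟦ (λ t x → cong (λ z → g z ⟨$⟩ʳ x) (++-assoc v w t)) ⟧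

·-cong : g ≋ h → a ≋ b → g · a ≋ h · b
·-cong {g = g} {h} {a} {b} ⟦ g≈h ⟧ ⟦ a≈b ⟧ = ⟦ (λ v x →
  trans (cong (a (act g v) ⟨$⟩ʳ_) (g≈h v x))
        (trans (cong (λ z → a z ⟨$⟩ʳ (h v ⟨$⟩ʳ x)) (act-cong ⟦ g≈h ⟧ v)) (a≈b _ _))) ⟧

inv-cong : g ≋ h → inv g ≋ inv h
inv-cong {g = g} {h} ⟦ g≈h ⟧ = ⟦ (λ v x →
  trans (cong (λ z → g z ⟨$⟩ˡ x) (actInv-cong ⟦ g≈h ⟧ v))
        (⟨$⟩ˡ-cong (g (actInv h v)) (h (actInv h v)) (g≈h (actInv h v)) x)) ⟧

·-identityˡ : (g : Aut d) → one · g ≋ g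
·-identityˡ g = ⟦ (λ v x → cong (λ z → g z ⟨$⟩ʳ x) (act-one v)) ⟧

·-identityʳ : (g : Aut d) → g · one ≋ g
·-identityʳ g = ⟦ (λ _ _ → refl) ⟧

inv-one : inv one ≋ one {d}
inv-one = ⟦ (λ _ _ → refl) ⟧

·-inverseˡ : (g : Aut d) → inv g · g ≋ one
·-inverseˡ g = ⟦ (λ v x →
  trans (cong (λ z → g z ⟨$⟩ʳ (g (actInv g v) ⟨$⟩ˡ x)) (act-inv g v)) (P.inverseʳ (g _))) ⟧

_^_ : Aut d → Aut d → Aut d
g ^ a = inv a · (g · a)

^-by-trivial : a ≋ one → g ^ a ≋ g
^-by-trivial {a = a} {g = g} a≈1 =
  ≋-trans (·-cong (≋-trans (inv-cong a≈1) inv-one) (·-cong (≋-refl {g = g}) a≈1))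
          (≋-trans (·-identityˡ (g · one)) (·-identityʳ g))

^-of-trivial : g ≋ one → g ^ a ≋ one
^-of-trivial {g = g} {a = a} g≈1 =
  ≋-trans (·-cong (≋-refl {g = inv a}) (≋-trans (·-cong g≈1 (≋-refl {g = a})) (·-identityˡ a))) (·-inverseˡ a)

record Sends {d : ℕ} (a : Aut d) (y y' : Word d) (α : Aut d) : Set where
  constructor sends
  field
    sends-act     : act a y ≡ y'
    sends-section : section a y ≋ α

sends-fixed : (a : Aut d) → Fixes a y → section a y ≈ α → Sends a y y α
sends-fixed a fixed sec = sends fixed ⟦ sec ⟧

Sends-resp : α ≋ β → Sends a y z α → Sends a y z β
Sends-resp α≈β (sends p q) = sends p (≋-trans q α≈β)

Sends-one : (w : Word d) → Sends one w w one
Sends-one w = sends (act-one w) ≋-refl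

Sends-· : Sends a y z α → Sends b z w β → Sends (a · b) y w (α · β)
Sends-· {a = a} {y = y} {b = b} (sends refl q) (sends refl q') =
  sends (act-· a b y) (≋-trans (section-· a b y) (·-cong q q'))

Sends-inv : Sends a y z α → Sends (inv a) z y (inv α)
Sends-inv {a = a} {y = y} (sends refl q) =
  sends (trans (act-inv a (act a y)) (actInv-act a y))
        (≋-trans (section-inv a (act a y))
                 (inv-cong (≋-trans (section-≡ a (actInv-act a y)) q)))

Sends-++ : Sends a y z α → Sends α u v β → Sends a (y ++ u) (z ++ v) β
Sends-++ {a = a} {y = y} {u = u} (sends refl q) (sends refl q') =
  sends (trans (act-++ a y u) (cong (act a y ++_) (act-cong q u)))
        (≋-trans (section-++ a y u) (≋-trans (section-cong q u) q'))

Sends-^ : Sends a z y α → Sends g z z β → Sends (g ^ a) y y (β ^ α)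
Sends-^ a-zy g-zz = Sends-· (Sends-inv a-zy) (Sends-· g-zz a-zy)

fixes-prefix : ∀ (g : Aut d) v w → Fixes g (v ++ w) → Fixes g v
fixes-prefix g v w fixed = prefix (act-length g v) (trans (sym (act-++ g v w)) fixed)
  where
  prefix : ∀ {v' w' : Word d} {v w} → length v' ≡ length v → v' ++ w' ≡ v ++ w → v' ≡ v
  prefix {v' = []}     {v = []}    _ _ = refl
  prefix {v' = x ∷ v'} {v = _ ∷ v} l e =
    cong₂ _∷_ (proj₁ (∷-injective e)) (prefix (suc-injective l) (proj₂ (∷-injective e)))

padTo : Fin d → ℕ → Word d → Word d
padTo x n v = v ++ replicate (n ∸ length v) x

length-padTo : (x : Fin d) (v : Word d) → length v ≤ n → length (padTo x n v) ≡ n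
length-padTo {n = n} x v |v|≤n =
  trans (length-++ v) (trans (cong (length v +_) (length-replicate (n ∸ length v))) (m+[n∸m]≡n |v|≤n))

InLevelStab-mono : {g : Aut d} → Fin d → n ≤ m → InLevelStab m g → InLevelStab n g
InLevelStab-mono {m = m} {g = g} x n≤m g∈St y refl =
  fixes-prefix g y (replicate (m ∸ length y) x) (g∈St (padTo x m y) (length-padTo x y n≤m))

InLevelStab-· : InLevelStab n g → InLevelStab n h → InLevelStab n (g · h)
InLevelStab-· {g = g} {h = h} g∈St h∈St y |y| =
  trans (act-· g h y) (trans (cong (act h) (g∈St y |y|)) (h∈St y |y|))

InLevelStab-inv : InLevelStab n g → InLevelStab n (inv g)
InLevelStab-inv {g = g} g∈St y |y| =
  trans (act-inv g y) (trans (cong (actInv g) (sym (g∈St y |y|))) (actInv-act g y))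

InLevelStab-inv-^-· : (K : Aut d) → InLevelStab n g → InLevelStab n (inv (K ^ g) · K)
InLevelStab-inv-^-· {n = n} {g = L} K L∈St y |y| = begin
  act (inv (K ^ L) · K) y         ≡⟨ act-· (inv (K ^ L)) K y ⟩
  act K (act (inv (K ^ L)) y)     ≡⟨ sym (agree (act (inv (K ^ L)) y) (trans (act-length _ y) |y|)) ⟩
  act (K ^ L) (act (inv (K ^ L)) y) ≡⟨ cong (act (K ^ L)) (act-inv (K ^ L) y) ⟩
  act (K ^ L) (actInv (K ^ L) y)  ≡⟨ act-actInv (K ^ L) y ⟩
  y                               ∎
  where
  open ≡-Reasoning
  agree : ∀ y → length y ≡ n → act (K ^ L) y ≡ act K y
  agree y |y| = begin
    act (K ^ L) y                  ≡⟨ act-· (inv L) (K · L) y ⟩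
    act (K · L) (act (inv L) y)    ≡⟨ act-· K L _ ⟩
    act L (act K (act (inv L) y))  ≡⟨ cong (λ z → act L (act K z)) (InLevelStab-inv L∈St y |y|) ⟩
    act L (act K y)                ≡⟨ L∈St (act K y) (trans (act-length K y) |y|) ⟩
    act K y                        ∎

module StSectionSubgroup {d : ℕ} {G : Aut d → Set} (isSubgroup : IsSubgroup G) where
  open IsSubgroup isSubgroup

  InStSection-intro : G h → InLevelStab n h → Sends h v v k → InStSection G n v k
  InStSection-intro h∈G h∈St (sends fixed sec) = _ , h∈G , h∈St , fixed , ≋⇒≈ sec

  InStSection-one : InStSection G n v one
  InStSection-one {v = v} = InStSection-intro one∈ (λ y _ → act-one y) (Sends-one v)

  InStSection-resp : g ≋ h → InStSection G n v g → InStSection G n v h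
  InStSection-resp g≋h (k , k∈G , k∈St , fixed , sec) =
    InStSection-intro k∈G k∈St (Sends-resp g≋h (sends-fixed k fixed sec))

  InStSection-· : InStSection G n v g → InStSection G n v h → InStSection G n v (g · h)
  InStSection-· {g = g} {h = h} (a , a∈G , a∈St , a-fix , a-sec) (b , b∈G , b∈St , b-fix , b-sec) =
    InStSection-intro (·∈ a b a∈G b∈G) (InLevelStab-· a∈St b∈St)
                      (Sends-· (sends-fixed {α = g} a a-fix a-sec) (sends-fixed {α = h} b b-fix b-sec))

  InStSection-inv : InStSection G n v g → InStSection G n v (inv g)
  InStSection-inv {g = g} (a , a∈G , a∈St , a-fix , a-sec) =
    InStSection-intro (inv∈ a a∈G) (InLevelStab-inv a∈St) (Sends-inv (sends-fixed {α = g} a a-fix a-sec))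

  InStSection-evalWord : (S : Aut d → Set) → (∀ s → S s → InStSection G n v s) →
                         ∀ ws → All (λ p → S (proj₂ p)) ws → InStSection G n v (evalWord ws)
  InStSection-evalWord S S⊆ []                 []         = InStSection-one
  InStSection-evalWord S S⊆ ((true , s) ∷ ws)  (Ss ∷ Sws) =
    InStSection-· {g = s} {h = evalWord ws} (S⊆ s Ss) (InStSection-evalWord S S⊆ ws Sws)
  InStSection-evalWord S S⊆ ((false , s) ∷ ws) (Ss ∷ Sws) =
    InStSection-· {g = inv s} {h = evalWord ws} (InStSection-inv {g = s} (S⊆ s Ss))
                  (InStSection-evalWord S S⊆ ws Sws)

module FractalSubgroup {d : ℕ} {G : Aut d → Set} (isSubgroup : IsSubgroup G) (fractal : IsFractal G) where
  open IsSubgroup isSubgroup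
  open StSectionSubgroup isSubgroup

  ^∈ : G g → G a → G (g ^ a)
  ^∈ {g = g} {a = a} g∈G a∈G = ·∈ (inv a) (g · a) (inv∈ a a∈G) (·∈ g a g∈G a∈G)

  fractal-lift : (x : Word d) → G k → ∃[ K ] (G K × Sends K x x k)
  fractal-lift {k = k} x k∈G with proj₂ (proj₂ (proj₂ fractal) x k) k∈G
  ... | K , K∈G , fixed , sec = K , K∈G , sends-fixed K fixed sec

  -- Correct the section of a transitive element by a lift of its inverse.
  fractal-transport : length w ≡ length v → ∃[ a ] (G a × Sends a w v one)
  fractal-transport {w = w} {v = v} |w|≡|v| with proj₁ (proj₂ fractal) w v |w|≡|v|
  ... | a , a∈G , a-wv with fractal-lift w (inv∈ (section a w) (proj₁ fractal a w a∈G))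
  ... | r , r∈G , r-ww =
    r · a , ·∈ r a r∈G a∈G ,
    Sends-resp (·-inverseˡ (section a w)) (Sends-· r-ww (sends a-wv ≋-refl))

  InStSection-by-conjugation : G k → G g → InLevelStab n g →
    Sends k v v α → Sends k y y one → Sends g y v β → InStSection G n v α
  InStSection-by-conjugation {k = K} {g = L} {v = v} {α = s} {β = β} K∈G L∈G L∈St K-vv K-yy L-yv =
    InStSection-intro (·∈ (inv (K ^ L)) K (inv∈ (K ^ L) (^∈ K∈G L∈G)) K∈G)
                      (InLevelStab-inv-^-· K L∈St) h-vv
    where
    K^L-vv : Sends (K ^ L) v v one
    K^L-vv = Sends-resp (^-of-trivial {a = β} ≋-refl) (Sends-^ L-yv K-yy)

    K^L⁻¹-vv : Sends (inv (K ^ L)) v v one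
    K^L⁻¹-vv = Sends-resp inv-one (Sends-inv K^L-vv)

    h-vv : Sends (inv (K ^ L) · K) v v s
    h-vv = Sends-resp (·-identityˡ s) (Sends-· K^L⁻¹-vv K-vv)

  module LevelStabTransitiveSubgroup (letter : Fin d) (transitive : LevelStabTransitive G) where

    InStSection-at-suffix : (x : Word d) → G g → Sends g v v α → Sends g y y one →
      length y ≡ length v → 1 ≤ length v → 1 ≤ n → n ≤ length x → InStSection G n (x ++ v) α
    InStSection-at-suffix {v = v} {y = y} x g∈G g-vv g-yy |y|≡|v| 1≤|v| 1≤n n≤|x|
      with fractal-lift x g∈G
         | transitive (length x) (≤-trans 1≤n n≤|x|) x refl (length v) 1≤|v| y v |y|≡|v| refl
    ... | K , K∈G , K-xx | L , L∈G , L∈St , L-xy =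
      InStSection-by-conjugation K∈G L∈G (InLevelStab-mono letter n≤|x| L∈St)
        (Sends-++ K-xx g-vv) (Sends-++ K-xx g-yy) (sends L-xy ≋-refl)

    InStSection-from-fixed-pair : (x : Word d) → G g → Sends g u u one → Sends g w w α →
      length u ≡ length w → length v ≡ length w → 1 ≤ length w → 1 ≤ n → n ≤ length x →
      InStSection G n (x ++ v) α
    InStSection-from-fixed-pair {u = u} {α = s} x g∈G g-uu g-ww |u|≡|w| |v|≡|w| 1≤|w| 1≤n n≤|x|
      with fractal-transport (sym |v|≡|w|)
    ... | a , a∈G , a-wv =
      InStSection-at-suffix x (^∈ g∈G a∈G)
        (Sends-resp (^-by-trivial {g = s} ≋-refl) (Sends-^ a-wv g-ww))
        (Sends-resp (^-of-trivial {a = section a u} ≋-refl) (Sends-^ (sends refl ≋-refl) g-uu))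
        (trans (act-length a u) (trans |u|≡|w| (sym |v|≡|w|)))
        (subst (1 ≤_) (sym |v|≡|w|) 1≤|w|) 1≤n n≤|x|

    -- If w is the root then so is u, and s = g|_w = g|_u = 1.  Otherwise u is padded
    -- to the length of w, and v is split as x b with |b| = |w|, so that |x| ≥ n.
    Condition⇒InStSection : (s : Aut d) (N : ℕ) → Condition G N s →
      ∀ n → 1 ≤ n → ∀ v → n + N ≤ length v → InStSection G n v s
    Condition⇒InStSection s N (g , _ , [] , [] , _ , _ , _ , _ , g≈1 , g≈s) n _ v _ =
      InStSection-resp {g = one} {h = s} (≋-trans (≋-sym (⟦_⟧ {g = g} {h = one} g≈1)) ⟦ g≈s ⟧)
                       InStSection-one
    Condition⇒InStSection s N
      (g , g∈G , u , w@(_ ∷ _) , |u|≤|w| , |w|≤N , u-fixed , w-fixed , g|u≈1 , g|w≈s) n 1≤n v n+N≤|v| =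
      subst (λ v → InStSection G n v s) (take++drop≡id j v)
        (InStSection-from-fixed-pair {α = s} {v = drop j v} (take j v) g∈G
          (Sends-++ (sends-fixed g u-fixed g|u≈1) (Sends-one (replicate (length w ∸ length u) letter)))
          (sends-fixed g w-fixed g|w≈s)
          (length-padTo letter u |u|≤|w|) |drop| (s≤s z≤n) 1≤n n≤|take|)
      where
      j = length v ∸ length w
      |w|≤|v| : length w ≤ length v
      |w|≤|v| = ≤-trans |w|≤N (≤-trans (m≤n+m N n) n+N≤|v|)
      |drop| : length (drop j v) ≡ length w
      |drop| = trans (length-drop j v) (m∸[m∸n]≡n |w|≤|v|)
      n≤|take| : n ≤ length (take j v)
      n≤|take| = +-cancelʳ-≤ (length w) n (length (take j v)) (begin
        n + length w                         ≤⟨ +-monoʳ-≤ n |w|≤N ⟩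
        n + N                                ≤⟨ n+N≤|v| ⟩
        length v                             ≡⟨ cong length (take++drop≡id j v) ⟨
        length (take j v ++ drop j v)        ≡⟨ length-++ (take j v) ⟩
        length (take j v) + length (drop j v) ≡⟨ cong (length (take j v) +_) |drop| ⟩
        length (take j v) + length w         ∎)
        where open ≤-Reasoning

    Condition⇒IsMixing : ∀ {N} {S : Aut d → Set} → Generates G S →
      (∀ s → S s → Condition G N s) → IsMixing G N
    Condition⇒IsMixing {N = N} {S = S} (_ , generates) condition =
      fractal , transitive , λ n m 1≤n _ v n+N≤|v| → St⊆π m v , π⊆St n m v 1≤n n+N≤|v|
      where
      St⊆π : ∀ m v h → G h → InLevelStab n h → Fixes h v → ∃[ g ] (G g × AgreeUpTo m (section h v) g)
      St⊆π m v h h∈G _ _ = section h v , proj₁ fractal h v h∈G , λ _ _ → refl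

      π⊆St : ∀ n m v → 1 ≤ n → n + N ≤ length v → ∀ g → G g →
        ∃[ h ] (G h × InLevelStab n h × Fixes h v × AgreeUpTo m (section h v) g)
      π⊆St n m v 1≤n n+N≤|v| g g∈G with generates g g∈G
      ... | ws , S-ws , g≈ws
        with InStSection-resp (≋-sym (⟦_⟧ {g = g} {h = evalWord ws} g≈ws))
               (InStSection-evalWord S (λ s Ss → Condition⇒InStSection s N (condition s Ss) n 1≤n v n+N≤|v|)
                                       ws S-ws)
      ... | h , h∈G , h∈St , fixed , sec =
        h , h∈G , h∈St , fixed , λ y _ → act-cong (⟦_⟧ {g = section h v} {h = g} sec) y

lemma2p3 : (d : ℕ) → 2 ≤ d → (G : Aut d → Set) → IsSubgroup G → IsFractal G →
    LevelStabTransitive G →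
    ((s : Aut d) (N : ℕ) → 1 ≤ N → G s → Condition G N s →
      ∀ (n : ℕ) → 1 ≤ n → ∀ (v : Word d) → n + N ≤ length v → InStSection G n v s)
    × ((S : Aut d → Set) (N : ℕ) → 1 ≤ N → Generates G S →
      (∀ s → S s → Condition G N s) → IsMixing G N)
lemma2p3 _ (s≤s _) G isSubgroup fractal transitive =
  (λ s N _ _ → Condition⇒InStSection s N) ,
  (λ S N _ generates condition → Condition⇒IsMixing generates condition)
  where open FractalSubgroup.LevelStabTransitiveSubgroup isSubgroup fractal zero transitive
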